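{- Let $G=(V,E)$ be a finite connected $d$-regular graph. Let $A\subset V$ be a nonempty set with $|A|\le|V|/2$ achieving $h_{out}(G)=|\partial_{out}A|/|A|$, and let $\Sigma=\partial_{out}A$. Set either $V^+=A$ or $V^+=V\setminus(A\cup\Sigma)$, and let $V^-$ be the other one; use this choice to define the signed distance $\mathrm{dist}_\Sigma$ (positive on $V^+$, negative on $V^-$). Let $\nu:\mathbb{Z}_{\ge0}\to\mathbb{R}$ be such that, for both choices of $V^+$ and all $k\ge0$, $|\mathrm{dist}_\Sigma^{ -1}(k)|\le|\Sigma|\nu(k)$. Then for all $k\ge0$, with $\Sigma_k=\mathrm{dist}_\Sigma^{ -1}(k)$, $$|\Sigma_k|\ge|\Sigma|\Bigl(1-h_{out}(G)\sum_{i=0}^k\nu(i)\Bigr).$$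
   Context: For $A\subset V$, $\partial_{out}A=\{y\notin A:\exists x\in A,\ x\sim y\}$. The outer vertex isoperimetric constant is $h_{out}(G)=\min|\partial_{out}A|/|A|$ over nonempty $A\subset V$ with $|A|\le\frac12|V|$. The signed distance $\mathrm{dist}_\Sigma(v)$ has absolute value $\min_{x\in\Sigma}\mathrm{dist}_G(x,v)$ and sign positive on $V^+$, negative on $V^-$ (zero on $\Sigma$).
   Formalization: The function ν takes values in ℚ rather than ℝ. -}

module Defs where

open import Data.Nat using (ℕ; zero; suc; _<_; _≤_; _*_)
open import Data.Integer as ℤ using (ℤ; +_)
open import Data.Rational as ℚ using (ℚ)
open import Data.Bool using (Bool; true; false; T; not; _∧_; _∨_; if_then_else_)
open import Data.Fin using (Fin)
open import Data.Fin.Subset using (Subset; _∈_; _∉_; ∣_∣; ∁; _∪_; Nonempty)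
open import Data.Vec using (tabulate; lookup)
open import Data.Product using (Σ; ∃; _×_; _,_)
open import Data.Sum using (_⊎_)
open import Relation.Nullary using (¬_)
open import Relation.Binary.PropositionalEquality using (_≡_)

record Graph (n : ℕ) : Set where
  field
    adj   : Fin n → Fin n → Bool
    sym   : ∀ x y → adj x y ≡ adj y x
    irrefl : ∀ x → adj x x ≡ false

module _ {n : ℕ} (G : Graph n) where
  open Graph G

  Adj : Fin n → Fin n → Set
  Adj x y = T (adj x y)

  N : Fin n → Subset n
  N x = tabulate (adj x)

  Regular : ℕ → Set
  Regular d = ∀ x → ∣ N x ∣ ≡ d

  data Walk : Fin n → Fin n → ℕ → Set where
    here : ∀ {x} → Walk x x 0
    step : ∀ {x y z k} → Adj x y → Walk y z k → Walk x z (suc k)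

  Connected : Set
  Connected = ∀ x y → ∃ λ k → Walk x y k

  Dist : Fin n → Fin n → ℕ → Set
  Dist x y m = Walk x y m × (∀ j → j < m → ¬ Walk x y j)

  DistFromSet : Subset n → Fin n → ℕ → Set
  DistFromSet S v m =
    (∃ λ x → x ∈ S × Walk x v m) × (∀ x j → x ∈ S → j < m → ¬ Walk x v j)

  anyFin : ∀ {k} → (Fin k → Bool) → Bool
  anyFin {zero}  f = false
  anyFin {suc k} f = f Fin.zero ∨ anyFin (λ i → f (Fin.suc i))

  ∂out : Subset n → Subset n
  ∂out A = tabulate λ y → not (lookup A y) ∧ anyFin (λ x → lookup A x ∧ adj x y)

  -- |∂_out B| / |B|  (only used for nonempty B; value 0 for the empty set)
  ratio : Subset n → ℚ
  ratio B with ∣ B ∣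
  ... | zero  = ℚ.0ℚ
  ... | suc m = (+ ∣ ∂out B ∣) ℚ./ suc m

  Admissible : Subset n → Set
  Admissible B = Nonempty B × 2 * ∣ B ∣ ≤ n

  IsHout : ℚ → Set
  IsHout h = (∃ λ B → Admissible B × ratio B ≡ h)
           × (∀ B → Admissible B → h ℚ.≤ ratio B)

  SignedDist : (Sg Vp Vm : Subset n) → Fin n → ℤ → Set
  SignedDist Sg Vp Vm v z = ∃ λ m → DistFromSet Sg v m ×
    ((v ∈ Sg × z ≡ + 0) ⊎ (v ∈ Vp × z ≡ + m) ⊎ (v ∈ Vm × z ≡ ℤ.- (+ m)))

  IsFibre : (Sg Vp Vm : Subset n) → ℤ → Subset n → Set
  IsFibre Sg Vp Vm z S = ∀ v → (v ∈ S → SignedDist Sg Vp Vm v z)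
                               × (SignedDist Sg Vp Vm v z → v ∈ S)

  Vplus Vminus : Subset n → Bool → Subset n
  Vplus  A b = if b then A else ∁ (A ∪ ∂out A)
  Vminus A b = if b then ∁ (A ∪ ∂out A) else A

sumTo : (ℕ → ℚ) → ℕ → ℚ
sumTo ν zero    = ν 0
sumTo ν (suc k) = sumTo ν k ℚ.+ ν (suc k)

ℕ→ℚ : ℕ → ℚ
ℕ→ℚ m = (+ m) ℚ./ 1

{-# OPTIONS --safe #-}

-- Write P for V⁺, Σ_k for the fibre dist_Σ⁻¹(k) and beyond k for the vertices of P at distance
-- more than k from Σ. Every neighbour of P outside P lies in Σ, so ∂_out(beyond k) ⊆ Σ_k, and
-- Σ_0, …, Σ_k, beyond k partition Σ ∪ P. If |beyond k| ≤ |V|/2 take X = beyond k; otherwise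
-- V⁺ is the outside of A and X = V ∖ (beyond k ∪ Σ_k) is small, contains A, and by symmetry of
-- adjacency again has ∂_out X ⊆ Σ_k. Either way h|X| ≤ |Σ_k| and |A| ≤ Σ_{i≤k}|Σ_i| + |X|, so,
-- as h|A| = |Σ| and Σ_{i≤k}|Σ_i| ≤ |Σ| Σ_{i≤k} ν(i),
--   |Σ| (1 - h Σ_{i≤k} ν(i)) ≤ h (|A| - Σ_{i≤k}|Σ_i|) ≤ h|X| ≤ |Σ_k|.

module Submission where

open import Defs
open import Data.Nat using (ℕ; _≤_; _*_)
open import Data.Integer using (+_)
open import Data.Rational using (ℚ; _+_; _-_; 1ℚ) renaming (_*_ to _*ℚ_; _≤_ to _≤ℚ_)
open import Data.Bool using (Bool; true; false)
open import Data.Fin.Subset using (Subset; ∣_∣)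
open import Relation.Binary.PropositionalEquality using (_≡_)

open import Data.Nat as ℕ using (zero; suc; _<_; z≤n; s≤s)
import Data.Nat.Properties as ℕ
open import Data.Integer as ℤ using ()
import Data.Integer.Properties as ℤ
open import Data.Integer.Tactic.RingSolver using (solve-∀)
open import Data.Rational using (0ℚ; -_; _/_; toℚᵘ; nonNegative)
import Data.Rational.Properties as ℚ
import Data.Rational.Unnormalised as ℚᵘ
import Data.Rational.Unnormalised.Properties as ℚᵘ
open import Data.Rational.Solver using (module +-*-Solver)
open import Data.Bool using (not; _∧_; T)
open import Data.Bool.Properties using (T-≡; T-∧)
open import Data.Unit using (tt)
open import Data.Fin using (Fin)
open import Data.Fin.Subset using (_∈_; _∉_; _⊆_; _∪_; _∩_; ∁; Empty; Nonempty)
open import Data.Fin.Subset.Properties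
open import Data.Vec using (_∷_; []; lookup; tabulate; here; there)
open import Data.Vec.Properties using (lookup∘tabulate; []=⇒lookup; lookup⇒[]=)
open import Data.Product using (∃; _×_; _,_; proj₁; proj₂)
open import Data.Sum using (inj₁; inj₂; [_,_]′)
open import Function using (_∘_; id; Equivalence)
open import Relation.Nullary using (Dec; yes; no; contradiction)
open import Relation.Nullary.Decidable using (decidable-stable)
open import Relation.Binary.PropositionalEquality using (refl; sym; trans; cong; subst; module ≡-Reasoning)

∣p∩q∣+∣p∩∁q∣≡∣p∣ : ∀ {n} (p q : Subset n) → ∣ p ∩ q ∣ ℕ.+ ∣ p ∩ ∁ q ∣ ≡ ∣ p ∣
∣p∩q∣+∣p∩∁q∣≡∣p∣ []          []          = refl
∣p∩q∣+∣p∩∁q∣≡∣p∣ (true  ∷ p) (true  ∷ q) = cong suc (∣p∩q∣+∣p∩∁q∣≡∣p∣ p q)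
∣p∩q∣+∣p∩∁q∣≡∣p∣ (true  ∷ p) (false ∷ q) =
  trans (ℕ.+-suc ∣ p ∩ q ∣ ∣ p ∩ ∁ q ∣) (cong suc (∣p∩q∣+∣p∩∁q∣≡∣p∣ p q))
∣p∩q∣+∣p∩∁q∣≡∣p∣ (false ∷ p) (_     ∷ q) = ∣p∩q∣+∣p∩∁q∣≡∣p∣ p q

∣p∪q∣≤∣p∣+∣q∣ : ∀ {n} (p q : Subset n) → ∣ p ∪ q ∣ ≤ ∣ p ∣ ℕ.+ ∣ q ∣
∣p∪q∣≤∣p∣+∣q∣ []            []            = z≤n
∣p∪q∣≤∣p∣+∣q∣ (true  ∷ p) (true  ∷ q) =
  s≤s (ℕ.≤-trans (∣p∪q∣≤∣p∣+∣q∣ p q) (ℕ.+-monoʳ-≤ ∣ p ∣ (ℕ.n≤1+n ∣ q ∣)))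
∣p∪q∣≤∣p∣+∣q∣ (true  ∷ p) (false ∷ q) = s≤s (∣p∪q∣≤∣p∣+∣q∣ p q)
∣p∪q∣≤∣p∣+∣q∣ (false ∷ p) (true  ∷ q) =
  ℕ.≤-trans (s≤s (∣p∪q∣≤∣p∣+∣q∣ p q)) (ℕ.≤-reflexive (sym (ℕ.+-suc ∣ p ∣ ∣ q ∣)))
∣p∪q∣≤∣p∣+∣q∣ (false ∷ p) (false ∷ q) = ∣p∪q∣≤∣p∣+∣q∣ p q

2*[n∸m]≤n : ∀ {m n} → n ≤ 2 * m → 2 * (n ℕ.∸ m) ≤ n
2*[n∸m]≤n {m} {n} n≤2m = begin
  2 * (n ℕ.∸ m)      ≡⟨ ℕ.*-distribˡ-∸ 2 n m ⟩
  2 * n ℕ.∸ 2 * m    ≤⟨ ℕ.∸-monoʳ-≤ (2 * n) n≤2m ⟩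
  2 * n ℕ.∸ n        ≡⟨ ℕ.m+n∸m≡n n (n ℕ.+ 0) ⟩
  n ℕ.+ 0            ≡⟨ ℕ.+-identityʳ n ⟩
  n                  ∎
  where open ℕ.≤-Reasoning

2*m≤n⇒m≤o+[n∸p] : ∀ {m n o p} → 2 * m ≤ n → p ≤ m ℕ.+ o → m ≤ o ℕ.+ (n ℕ.∸ p)
2*m≤n⇒m≤o+[n∸p] {m} {n} {o} {p} 2m≤n p≤m+o = ℕ.+-cancelˡ-≤ m m (o ℕ.+ (n ℕ.∸ p)) (begin
  m ℕ.+ m                  ≡⟨ cong (m ℕ.+_) (ℕ.+-identityʳ m) ⟨
  2 * m                    ≤⟨ 2m≤n ⟩
  n                        ≤⟨ ℕ.m≤n+m∸n n p ⟩
  p ℕ.+ (n ℕ.∸ p)          ≤⟨ ℕ.+-monoˡ-≤ (n ℕ.∸ p) p≤m+o ⟩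
  m ℕ.+ o ℕ.+ (n ℕ.∸ p)    ≡⟨ ℕ.+-assoc m o (n ℕ.∸ p) ⟩
  m ℕ.+ (o ℕ.+ (n ℕ.∸ p))  ∎)
  where open ℕ.≤-Reasoning

toℚᵘ-ℕ→ℚ : ∀ m → toℚᵘ (ℕ→ℚ m) ℚᵘ.≃ ℚᵘ.mkℚᵘ (+ m) 0
toℚᵘ-ℕ→ℚ m = ℚ.toℚᵘ-fromℚᵘ (ℚᵘ.mkℚᵘ (+ m) 0)

ℕ→ℚ-+ : ∀ a b → ℕ→ℚ (a ℕ.+ b) ≡ ℕ→ℚ a + ℕ→ℚ b
ℕ→ℚ-+ a b = ℚ.toℚᵘ-injective (begin
  toℚᵘ (ℕ→ℚ (a ℕ.+ b))                  ≈⟨ toℚᵘ-ℕ→ℚ (a ℕ.+ b) ⟩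
  ℚᵘ.mkℚᵘ (+ (a ℕ.+ b)) 0               ≈⟨ ℚᵘ.*≡* (trans (cong (ℤ._* + 1) (ℤ.pos-+ a b)) (+-over-1 (+ a) (+ b))) ⟩
  ℚᵘ.mkℚᵘ (+ a) 0 ℚᵘ.+ ℚᵘ.mkℚᵘ (+ b) 0  ≈⟨ ℚᵘ.+-cong (ℚᵘ.≃-sym (toℚᵘ-ℕ→ℚ a)) (ℚᵘ.≃-sym (toℚᵘ-ℕ→ℚ b)) ⟩
  toℚᵘ (ℕ→ℚ a) ℚᵘ.+ toℚᵘ (ℕ→ℚ b)        ≈⟨ ℚᵘ.≃-sym (ℚ.toℚᵘ-homo-+ (ℕ→ℚ a) (ℕ→ℚ b)) ⟩
  toℚᵘ (ℕ→ℚ a + ℕ→ℚ b)                  ∎)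
  where
  open ℚᵘ.≃-Reasoning
  +-over-1 : ∀ x y → (x ℤ.+ y) ℤ.* + 1 ≡ (x ℤ.* + 1 ℤ.+ y ℤ.* + 1) ℤ.* + 1
  +-over-1 = solve-∀

[s/d]*d≡s : ∀ s m → ((+ s) / suc m) *ℚ ℕ→ℚ (suc m) ≡ ℕ→ℚ s
[s/d]*d≡s s m = ℚ.toℚᵘ-injective (begin
  toℚᵘ ((+ s / suc m) *ℚ ℕ→ℚ (suc m))            ≈⟨ ℚ.toℚᵘ-homo-* (+ s / suc m) (ℕ→ℚ (suc m)) ⟩
  toℚᵘ (+ s / suc m) ℚᵘ.* toℚᵘ (ℕ→ℚ (suc m))    ≈⟨ ℚᵘ.*-cong (ℚ.toℚᵘ-fromℚᵘ (ℚᵘ.mkℚᵘ (+ s) m)) (toℚᵘ-ℕ→ℚ (suc m)) ⟩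
  ℚᵘ.mkℚᵘ (+ s) m ℚᵘ.* ℚᵘ.mkℚᵘ (+ suc m) 0      ≈⟨ ℚᵘ.*≡* (*-over-1 (+ s) (+ suc m)) ⟩
  ℚᵘ.mkℚᵘ (+ s) 0                               ≈⟨ ℚᵘ.≃-sym (toℚᵘ-ℕ→ℚ s) ⟩
  toℚᵘ (ℕ→ℚ s)                                  ∎)
  where
  open ℚᵘ.≃-Reasoning
  *-over-1 : ∀ x y → (x ℤ.* y) ℤ.* + 1 ≡ x ℤ.* (y ℤ.* + 1)
  *-over-1 = solve-∀

0≤ℕ→ℚ : ∀ m → 0ℚ ≤ℚ ℕ→ℚ m
0≤ℕ→ℚ m = ℚ.nonNegative⁻¹ (ℕ→ℚ m) {{ℚ.normalize-nonNeg m 1}}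

ℕ→ℚ-mono-≤ : ∀ {a b} → a ≤ b → ℕ→ℚ a ≤ℚ ℕ→ℚ b
ℕ→ℚ-mono-≤ {a} {b} a≤b = begin
  ℕ→ℚ a                  ≡⟨ ℚ.+-identityʳ (ℕ→ℚ a) ⟨
  ℕ→ℚ a + 0ℚ             ≤⟨ ℚ.+-monoʳ-≤ (ℕ→ℚ a) (0≤ℕ→ℚ (b ℕ.∸ a)) ⟩
  ℕ→ℚ a + ℕ→ℚ (b ℕ.∸ a)  ≡⟨ ℕ→ℚ-+ a (b ℕ.∸ a) ⟨
  ℕ→ℚ (a ℕ.+ (b ℕ.∸ a))  ≡⟨ cong ℕ→ℚ (ℕ.m+[n∸m]≡n a≤b) ⟩
  ℕ→ℚ b                  ∎
  where open ℚ.≤-Reasoning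

sumToℕ : (ℕ → ℕ) → ℕ → ℕ
sumToℕ f zero    = f 0
sumToℕ f (suc k) = sumToℕ f k ℕ.+ f (suc k)

sumToℕ-≤-*sumTo : ∀ (f : ℕ → ℕ) (c : ℚ) (ν : ℕ → ℚ) → (∀ i → ℕ→ℚ (f i) ≤ℚ c *ℚ ν i) →
  ∀ k → ℕ→ℚ (sumToℕ f k) ≤ℚ c *ℚ sumTo ν k
sumToℕ-≤-*sumTo f c ν f≤cν zero    = f≤cν 0
sumToℕ-≤-*sumTo f c ν f≤cν (suc k) = begin
  ℕ→ℚ (sumToℕ f k ℕ.+ f (suc k))        ≡⟨ ℕ→ℚ-+ (sumToℕ f k) (f (suc k)) ⟩
  ℕ→ℚ (sumToℕ f k) + ℕ→ℚ (f (suc k))    ≤⟨ ℚ.+-mono-≤ (sumToℕ-≤-*sumTo f c ν f≤cν k) (f≤cν (suc k)) ⟩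
  c *ℚ sumTo ν k + c *ℚ ν (suc k)        ≡⟨ ℚ.*-distribˡ-+ c (sumTo ν k) (ν (suc k)) ⟨
  c *ℚ sumTo ν (suc k)                   ∎
  where open ℚ.≤-Reasoning

s*[1-h*σ]≤f : ∀ {s a t x f h σ : ℚ} → 0ℚ ≤ℚ h → h *ℚ a ≡ s → t ≤ℚ s *ℚ σ → a ≤ℚ t + x → h *ℚ x ≤ℚ f →
  s *ℚ (1ℚ - h *ℚ σ) ≤ℚ f
s*[1-h*σ]≤f {s} {a} {t} {x} {f} {h} {σ} 0≤h ha≡s t≤sσ a≤t+x hx≤f = begin
  s *ℚ (1ℚ - h *ℚ σ)        ≡⟨ expand s h σ ⟩
  s - h *ℚ (s *ℚ σ)         ≤⟨ ℚ.+-monoʳ-≤ s (ℚ.neg-antimono-≤ (ℚ.*-monoˡ-≤-nonNeg h t≤sσ)) ⟩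
  s - h *ℚ t                ≡⟨ cong (_- h *ℚ t) ha≡s ⟨
  h *ℚ a - h *ℚ t           ≤⟨ ℚ.+-monoˡ-≤ (- (h *ℚ t)) (ℚ.*-monoˡ-≤-nonNeg h a≤t+x) ⟩
  h *ℚ (t + x) - h *ℚ t     ≡⟨ cancel h t x ⟩
  h *ℚ x                    ≤⟨ hx≤f ⟩
  f                         ∎
  where
  open ℚ.≤-Reasoning
  open +-*-Solver
  instance _ = nonNegative 0≤h
  expand : ∀ s h σ → s *ℚ (1ℚ - h *ℚ σ) ≡ s - h *ℚ (s *ℚ σ)
  expand = solve 3 (λ s h σ → s :* (con 1ℚ :- h :* σ) := s :- h :* (s :* σ)) refl
  cancel : ∀ h t x → h *ℚ (t + x) - h *ℚ t ≡ h *ℚ x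
  cancel = solve 3 (λ h t x → h :* (t :+ x) :- h :* t := h :* x) refl

module _ {n : ℕ} {p : Subset n} {x : Fin n} where

  ∈⇒T : x ∈ p → T (lookup p x)
  ∈⇒T x∈p = Equivalence.from T-≡ ([]=⇒lookup x∈p)

  T⇒∈ : T (lookup p x) → x ∈ p
  T⇒∈ t = lookup⇒[]= x p (Equivalence.to T-≡ t)

  ∉⇒T-not : x ∉ p → T (not (lookup p x))
  ∉⇒T-not x∉p with lookup p x in eq
  ... | true  = x∉p (lookup⇒[]= x p eq)
  ... | false = tt

  T-not⇒∉ : T (not (lookup p x)) → x ∉ p
  T-not⇒∉ t x∈p with lookup p x | []=⇒lookup x∈p
  T-not⇒∉ () x∈p | true | refl

∈-tabulate⁺ : ∀ {n} {f : Fin n → Bool} {x} → T (f x) → x ∈ tabulate f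
∈-tabulate⁺ {f = f} {x} = T⇒∈ ∘ subst T (sym (lookup∘tabulate f x))

∈-tabulate⁻ : ∀ {n} {f : Fin n → Bool} {x} → x ∈ tabulate f → T (f x)
∈-tabulate⁻ {f = f} {x} = subst T (lookup∘tabulate f x) ∘ ∈⇒T

module _ {n : ℕ} (G : Graph n) where

  anyFin⁺ : ∀ {k} {f : Fin k → Bool} i → T (f i) → T (anyFin G f)
  anyFin⁺ {f = f} Fin.zero    t with f Fin.zero
  ... | true = tt
  anyFin⁺ {f = f} (Fin.suc i) t with f Fin.zero
  ... | true  = tt
  ... | false = anyFin⁺ i t

  anyFin⁻ : ∀ {k} {f : Fin k → Bool} → T (anyFin G f) → ∃ λ i → T (f i)
  anyFin⁻ {suc k} {f} t with f Fin.zero in eq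
  ... | true  = Fin.zero , Equivalence.from T-≡ eq
  ... | false with anyFin⁻ t
  ...   | i , fi = Fin.suc i , fi

  Adj-sym : ∀ {x y} → Adj G x y → Adj G y x
  Adj-sym {x} {y} = subst T (Graph.sym G x y)

  ∈∂out⁺ : ∀ {A x y} → x ∈ A → Adj G x y → y ∉ A → y ∈ ∂out G A
  ∈∂out⁺ {x = x} x∈A xy y∉A =
    ∈-tabulate⁺ (Equivalence.from T-∧ (∉⇒T-not y∉A , anyFin⁺ x (Equivalence.from T-∧ (∈⇒T x∈A , xy))))

  ∈∂out⁻ : ∀ {A y} → y ∈ ∂out G A → y ∉ A × ∃ λ x → x ∈ A × Adj G x y
  ∈∂out⁻ y∈∂A with Equivalence.to T-∧ (∈-tabulate⁻ y∈∂A)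
  ... | y∉A , t with anyFin⁻ t
  ...   | x , x∈A∧xy with Equivalence.to T-∧ x∈A∧xy
  ...     | x∈A , xy = T-not⇒∉ y∉A , x , T⇒∈ x∈A , xy

  ∂out-∁-⊆ : ∀ {X Y} → ∂out G X ⊆ Y → ∂out G (∁ (X ∪ Y)) ⊆ Y
  ∂out-∁-⊆ {X} {Y} ∂X⊆Y v∈∂ with ∈∂out⁻ v∈∂
  ... | v∉ , u , u∈ , uv with x∈p∪q⁻ X Y (x∉∁p⇒x∈p v∉)
  ...   | inj₂ v∈Y = v∈Y
  ...   | inj₁ v∈X = contradiction (∂X⊆Y (∈∂out⁺ v∈X (Adj-sym uv) (u∉X∪Y ∘ p⊆p∪q Y))) (u∉X∪Y ∘ q⊆p∪q X Y)
    where u∉X∪Y = x∈∁p⇒x∉p u∈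

  Walk-snoc : ∀ {x u v j} → Walk G x u j → Adj G u v → Walk G x v (suc j)
  Walk-snoc here        uv = step uv here
  Walk-snoc (step a w) uv = step a (Walk-snoc w uv)

module Balls {n : ℕ} (G : Graph n) (S : Subset n) where

  ball : ℕ → Subset n
  ball zero    = S
  ball (suc k) = ball k ∪ ∂out G (ball k)

  ball-⊆-suc : ∀ k → ball k ⊆ ball (suc k)
  ball-⊆-suc k = p⊆p∪q (∂out G (ball k))

  ball-mono : ∀ {j k} → j ≤ k → ball j ⊆ ball k
  ball-mono {k = zero}  z≤n = id
  ball-mono {k = suc k} j≤k with ℕ.m≤n⇒m<n∨m≡n j≤k
  ... | inj₁ j<k  = ball-⊆-suc k ∘ ball-mono (ℕ.≤-pred j<k)
  ... | inj₂ refl = id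

  ball-adj : ∀ k {u v} → u ∈ ball k → Adj G u v → v ∈ ball (suc k)
  ball-adj k {v = v} u∈ uv with v ∈? ball k
  ... | yes v∈ = ball-⊆-suc k v∈
  ... | no  v∉ = q⊆p∪q (ball k) _ (∈∂out⁺ G u∈ uv v∉)

  walk⇒∈ball : ∀ {i j x v} → x ∈ ball i → Walk G x v j → v ∈ ball (i ℕ.+ j)
  walk⇒∈ball {i} {v = v} x∈ here = subst (λ m → v ∈ ball m) (sym (ℕ.+-identityʳ i)) x∈
  walk⇒∈ball {i} {suc j} {v = v} x∈ (step xy w) =
    subst (λ m → v ∈ ball m) (sym (ℕ.+-suc i j)) (walk⇒∈ball {suc i} (ball-adj i x∈ xy) w)

  ∈ball⇒walk : ∀ {k v} → v ∈ ball k → ∃ λ x → x ∈ S × ∃ λ j → j ≤ k × Walk G x v j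
  ∈ball⇒walk {zero} {v} v∈S = v , v∈S , 0 , z≤n , here
  ∈ball⇒walk {suc k} v∈ with x∈p∪q⁻ (ball k) _ v∈
  ... | inj₁ v∈ball =
    let x , x∈S , j , j≤k , w = ∈ball⇒walk v∈ball in x , x∈S , j , ℕ.m≤n⇒m≤1+n j≤k , w
  ... | inj₂ v∈∂ with ∈∂out⁻ G v∈∂
  ...   | _ , u , u∈ , uv =
    let x , x∈S , j , j≤k , w = ∈ball⇒walk u∈ in x , x∈S , suc j , s≤s j≤k , Walk-snoc G w uv

  dist⇒∈ball : ∀ {v m} → DistFromSet G S v m → v ∈ ball m
  dist⇒∈ball ((x , x∈S , w) , _) = walk⇒∈ball {0} x∈S w

  dist⇒∉ball : ∀ {v m j} → DistFromSet G S v m → j < m → v ∉ ball j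
  dist⇒∉ball (_ , minimal) j<m v∈ with ∈ball⇒walk v∈
  ... | x , x∈S , i , i≤j , w = minimal x i x∈S (ℕ.≤-<-trans i≤j j<m) w

  ∈ball⇒dist : ∀ {v m} → v ∈ ball m → (∀ {j} → j < m → v ∉ ball j) → DistFromSet G S v m
  ∈ball⇒dist v∈ nearer∉ with ∈ball⇒walk v∈
  ... | x , x∈S , j , j≤m , w with ℕ.m≤n⇒m<n∨m≡n j≤m
  ...   | inj₁ j<m  = contradiction (walk⇒∈ball {0} x∈S w) (nearer∉ j<m)
  ...   | inj₂ refl = (x , x∈S , w) , λ y i y∈S i<m w′ → nearer∉ i<m (walk⇒∈ball {0} y∈S w′)

module Layers {n : ℕ} (G : Graph n) (S P : Subset n) where
  open Balls G S public

  beyond : ℕ → Subset n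
  beyond k = P ∩ ∁ (ball k)

  layer : ℕ → Subset n
  layer zero    = S
  layer (suc k) = beyond k ∩ ball (suc k)

  layer⇒signedDist : ∀ Q k {v} → v ∈ layer k → SignedDist G S P Q v (+ k)
  layer⇒signedDist Q zero v∈S = 0 , ∈ball⇒dist v∈S (λ ()) , inj₁ (v∈S , refl)
  layer⇒signedDist Q (suc k) v∈ with x∈p∩q⁻ _ _ v∈
  ... | v∈beyond , v∈ball with x∈p∩q⁻ P _ v∈beyond
  ...   | v∈P , v∈∁ball =
    suc k , ∈ball⇒dist v∈ball (λ j<1+k → x∈∁p⇒x∉p v∈∁ball ∘ ball-mono (ℕ.≤-pred j<1+k)) ,
    inj₂ (inj₁ (v∈P , refl))

  signedDist⇒layer : ∀ Q k {v} → SignedDist G S P Q v (+ k) → v ∈ layer k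
  signedDist⇒layer Q zero    (_     , _ , inj₁ (v∈S , _))          = v∈S
  signedDist⇒layer Q zero    (zero  , d , inj₂ _)                  = dist⇒∈ball d
  signedDist⇒layer Q zero    (suc m , _ , inj₂ (inj₁ (_ , ())))
  signedDist⇒layer Q zero    (suc m , _ , inj₂ (inj₂ (_ , ())))
  signedDist⇒layer Q (suc k) (_     , _ , inj₁ (_ , ()))
  signedDist⇒layer Q (suc k) (_     , d , inj₂ (inj₁ (v∈P , refl))) =
    x∈p∩q⁺ (x∈p∩q⁺ (v∈P , x∉p⇒x∈∁p (dist⇒∉ball d ℕ.≤-refl)) , dist⇒∈ball d)
  signedDist⇒layer Q (suc k) (zero  , _ , inj₂ (inj₂ (_ , ())))
  signedDist⇒layer Q (suc k) (suc m , _ , inj₂ (inj₂ (_ , ())))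

  layer-isFibre : ∀ Q k → IsFibre G S P Q (+ k) (layer k)
  layer-isFibre Q k v = layer⇒signedDist Q k , signedDist⇒layer Q k

isFibre-unique : ∀ {n} {G : Graph n} {S P Q F F′ z} →
  IsFibre G S P Q z F → IsFibre G S P Q z F′ → F ≡ F′
isFibre-unique fib fib′ =
  ⊆-antisym (λ {v} → proj₂ (fib′ v) ∘ proj₁ (fib v)) (λ {v} → proj₂ (fib v) ∘ proj₁ (fib′ v))

x∈p⇒0<∣p∣ : ∀ {n} {p : Subset n} {x} → x ∈ p → 0 < ∣ p ∣
x∈p⇒0<∣p∣ here                      = s≤s z≤n
x∈p⇒0<∣p∣ {p = s ∷ p} (there x∈p) = ℕ.<-≤-trans (x∈p⇒0<∣p∣ x∈p) (∣p∣≤∣x∷p∣ s p)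

module _ {n : ℕ} (G : Graph n) where

  0≤ratio : ∀ B → 0ℚ ≤ℚ ratio G B
  0≤ratio B with ∣ B ∣
  ... | zero  = ℚ.≤-refl
  ... | suc m = ℚ.nonNegative⁻¹ _ {{ℚ.normalize-nonNeg ∣ ∂out G B ∣ (suc m)}}

  ratio-*-∣∣ : ∀ B → Nonempty B → ratio G B *ℚ ℕ→ℚ ∣ B ∣ ≡ ℕ→ℚ ∣ ∂out G B ∣
  ratio-*-∣∣ B (_ , x∈B) with ∣ B ∣ | x∈p⇒0<∣p∣ x∈B
  ... | suc m | _ = [s/d]*d≡s ∣ ∂out G B ∣ m

  isoperimetric : ∀ {h} → (∀ B → Admissible G B → h ≤ℚ ratio G B) →
    ∀ B → 2 * ∣ B ∣ ≤ n → h *ℚ ℕ→ℚ ∣ B ∣ ≤ℚ ℕ→ℚ ∣ ∂out G B ∣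
  isoperimetric {h} h≤ratio B 2∣B∣≤n with nonempty? B
  ... | yes B≢∅ = begin
    h *ℚ ℕ→ℚ ∣ B ∣           ≤⟨ ℚ.*-monoʳ-≤-nonNeg (ℕ→ℚ ∣ B ∣) {{ℚ.normalize-nonNeg ∣ B ∣ 1}}
                                  (h≤ratio B (B≢∅ , 2∣B∣≤n)) ⟩
    ratio G B *ℚ ℕ→ℚ ∣ B ∣   ≡⟨ ratio-*-∣∣ B B≢∅ ⟩
    ℕ→ℚ ∣ ∂out G B ∣         ∎
    where open ℚ.≤-Reasoning
  ... | no  B≡∅ = begin
    h *ℚ ℕ→ℚ ∣ B ∣           ≡⟨ cong (λ m → h *ℚ ℕ→ℚ m) (trans (cong ∣_∣ (Empty-unique B≡∅)) (∣⊥∣≡0 n)) ⟩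
    h *ℚ 0ℚ                  ≡⟨ ℚ.*-zeroʳ h ⟩
    0ℚ                       ≤⟨ 0≤ℕ→ℚ ∣ ∂out G B ∣ ⟩
    ℕ→ℚ ∣ ∂out G B ∣         ∎
    where open ℚ.≤-Reasoning

module Separated {n : ℕ} (G : Graph n) (S P : Subset n) (∂P⊆S : ∂out G P ⊆ S) where
  open Layers G S P public

  ∂out-beyond⊆layer : ∀ k → ∂out G (beyond k) ⊆ layer k
  ∂out-beyond⊆layer zero {v} v∈∂ with v ∈? S | ∈∂out⁻ G v∈∂
  ... | yes v∈S | _ = v∈S
  ... | no  v∉S | v∉beyond , x , x∈beyond , xv =
    ∂P⊆S (∈∂out⁺ G (p∩q⊆p P _ x∈beyond) xv (λ v∈P → v∉beyond (x∈p∩q⁺ (v∈P , x∉p⇒x∈∁p v∉S))))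
  ∂out-beyond⊆layer (suc k) {v} v∈∂ with ∈∂out⁻ G v∈∂
  ... | v∉beyond , x , x∈beyond , xv = x∈p∩q⁺ (x∈p∩q⁺ (v∈P , x∉p⇒x∈∁p v∉ball) , v∈ball)
    where
    v∉ball : v ∉ ball k
    v∉ball v∈ = x∈∁p⇒x∉p (proj₂ (x∈p∩q⁻ P _ x∈beyond)) (ball-adj k v∈ (Adj-sym G xv))
    v∈P : v ∈ P
    v∈P = decidable-stable (v ∈? P) λ v∉P →
      v∉ball (ball-mono {k = k} z≤n (∂P⊆S (∈∂out⁺ G (p∩q⊆p P _ x∈beyond) xv v∉P)))
    v∈ball : v ∈ ball (suc k)
    v∈ball = decidable-stable (v ∈? ball (suc k)) λ v∉ →
      v∉beyond (x∈p∩q⁺ (v∈P , x∉p⇒x∈∁p v∉))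

  beyond∪layer⊆P∪S : ∀ k → beyond k ∪ layer k ⊆ P ∪ S
  beyond∪layer⊆P∪S k v∈ with x∈p∪q⁻ (beyond k) (layer k) v∈
  ... | inj₁ v∈beyond = p⊆p∪q S (p∩q⊆p P _ v∈beyond)
  ... | inj₂ v∈layer  = layer⊆P∪S k v∈layer
    where
    layer⊆P∪S : ∀ k → layer k ⊆ P ∪ S
    layer⊆P∪S zero    = q⊆p∪q P S
    layer⊆P∪S (suc k) = p⊆p∪q S ∘ p∩q⊆p P _ ∘ p∩q⊆p _ _

  beyond-∩-∁ball-suc : ∀ k → beyond k ∩ ∁ (ball (suc k)) ≡ beyond (suc k)
  beyond-∩-∁ball-suc k = ⊆-antisym
    (λ v∈ → let v∈beyond , v∉ = x∈p∩q⁻ _ _ v∈ in x∈p∩q⁺ (p∩q⊆p P _ v∈beyond , v∉))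
    (λ v∈ → let v∈P , v∉ = x∈p∩q⁻ P _ v∈ in
      x∈p∩q⁺ (x∈p∩q⁺ (v∈P , x∉p⇒x∈∁p (x∈∁p⇒x∉p v∉ ∘ ball-⊆-suc k)) , v∉))

  ∣layers∣+∣beyond∣ : Empty (P ∩ S) → ∀ k → sumToℕ (∣_∣ ∘ layer) k ℕ.+ ∣ beyond k ∣ ≡ ∣ S ∣ ℕ.+ ∣ P ∣
  ∣layers∣+∣beyond∣ P∩S≡∅ zero = cong (∣ S ∣ ℕ.+_) (begin
    ∣ P ∩ ∁ S ∣                  ≡⟨ cong (ℕ._+ ∣ P ∩ ∁ S ∣) ∣P∩S∣≡0 ⟨
    ∣ P ∩ S ∣ ℕ.+ ∣ P ∩ ∁ S ∣    ≡⟨ ∣p∩q∣+∣p∩∁q∣≡∣p∣ P S ⟩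
    ∣ P ∣                        ∎)
    where
    open ≡-Reasoning
    ∣P∩S∣≡0 : ∣ P ∩ S ∣ ≡ 0
    ∣P∩S∣≡0 = trans (cong ∣_∣ (Empty-unique P∩S≡∅)) (∣⊥∣≡0 n)
  ∣layers∣+∣beyond∣ P∩S≡∅ (suc k) = begin
    sumToℕ (∣_∣ ∘ layer) k ℕ.+ ∣ layer (suc k) ∣ ℕ.+ ∣ beyond (suc k) ∣
      ≡⟨ ℕ.+-assoc (sumToℕ (∣_∣ ∘ layer) k) _ _ ⟩
    sumToℕ (∣_∣ ∘ layer) k ℕ.+ (∣ layer (suc k) ∣ ℕ.+ ∣ beyond (suc k) ∣)
      ≡⟨ cong (λ B → sumToℕ (∣_∣ ∘ layer) k ℕ.+ (∣ layer (suc k) ∣ ℕ.+ ∣ B ∣)) (beyond-∩-∁ball-suc k) ⟨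
    sumToℕ (∣_∣ ∘ layer) k ℕ.+ (∣ layer (suc k) ∣ ℕ.+ ∣ beyond k ∩ ∁ (ball (suc k)) ∣)
      ≡⟨ cong (sumToℕ (∣_∣ ∘ layer) k ℕ.+_) (∣p∩q∣+∣p∩∁q∣≡∣p∣ (beyond k) (ball (suc k))) ⟩
    sumToℕ (∣_∣ ∘ layer) k ℕ.+ ∣ beyond k ∣
      ≡⟨ ∣layers∣+∣beyond∣ P∩S≡∅ k ⟩
    ∣ S ∣ ℕ.+ ∣ P ∣ ∎
    where open ≡-Reasoning

  IsoperimetricWitness : ℕ → ℕ → Set
  IsoperimetricWitness a k =
    ∃ λ X → 2 * ∣ X ∣ ≤ n × ∂out G X ⊆ layer k × a ≤ sumToℕ (∣_∣ ∘ layer) k ℕ.+ ∣ X ∣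

  layer-lower-bound : ∀ {h a k} (ν : ℕ → ℚ) → (∀ B → Admissible G B → h ≤ℚ ratio G B) →
    0ℚ ≤ℚ h → h *ℚ ℕ→ℚ a ≡ ℕ→ℚ ∣ S ∣ → (∀ i → ℕ→ℚ ∣ layer i ∣ ≤ℚ ℕ→ℚ ∣ S ∣ *ℚ ν i) →
    IsoperimetricWitness a k → ℕ→ℚ ∣ S ∣ *ℚ (1ℚ - h *ℚ sumTo ν k) ≤ℚ ℕ→ℚ ∣ layer k ∣
  layer-lower-bound {h} {a} {k} ν h≤ratio 0≤h ha≡s layer≤ (X , 2∣X∣≤n , ∂X⊆layer , a≤) =
    s*[1-h*σ]≤f 0≤h ha≡s (sumToℕ-≤-*sumTo (∣_∣ ∘ layer) (ℕ→ℚ ∣ S ∣) ν layer≤ k)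
      (subst (ℕ→ℚ a ≤ℚ_) (ℕ→ℚ-+ (sumToℕ (∣_∣ ∘ layer) k) ∣ X ∣) (ℕ→ℚ-mono-≤ a≤))
      (ℚ.≤-trans (isoperimetric G h≤ratio X 2∣X∣≤n) (ℕ→ℚ-mono-≤ (p⊆q⇒∣p∣≤∣q∣ ∂X⊆layer)))

module _ {n : ℕ} (G : Graph n) (A : Subset n) where

  Vplus-∂out⊆∂out : ∀ b → ∂out G (Vplus G A b) ⊆ ∂out G A
  Vplus-∂out⊆∂out true  = id
  Vplus-∂out⊆∂out false = ∂out-∁-⊆ G {A} {∂out G A} id

  Vplus∩∂out-empty : ∀ b → Empty (Vplus G A b ∩ ∂out G A)
  Vplus∩∂out-empty true  (v , v∈) = let v∈A , v∈∂A = x∈p∩q⁻ A _ v∈ in proj₁ (∈∂out⁻ G v∈∂A) v∈A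
  Vplus∩∂out-empty false (v , v∈) = let v∈P , v∈∂A = x∈p∩q⁻ _ _ v∈ in x∈∁p⇒x∉p v∈P (q⊆p∪q A _ v∈∂A)

  module Inner = Separated G (∂out G A) (Vplus G A true) (Vplus-∂out⊆∂out true)
  module Outer = Separated G (∂out G A) (Vplus G A false) (Vplus-∂out⊆∂out false)

  inner-witness : 2 * ∣ A ∣ ≤ n → ∀ k → Inner.IsoperimetricWitness ∣ A ∣ k
  inner-witness 2∣A∣≤n k =
    beyond k , ℕ.≤-trans (ℕ.*-monoʳ-≤ 2 (p⊆q⇒∣p∣≤∣q∣ (p∩q⊆p A _))) 2∣A∣≤n , ∂out-beyond⊆layer k ,
    ℕ.≤-trans (ℕ.m≤n+m ∣ A ∣ ∣ ∂out G A ∣)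
              (ℕ.≤-reflexive (sym (∣layers∣+∣beyond∣ (Vplus∩∂out-empty true) k)))
    where open Inner

  outer-witness : 2 * ∣ A ∣ ≤ n → ∀ k → Outer.IsoperimetricWitness ∣ A ∣ k
  outer-witness 2∣A∣≤n k = choose (2 * ∣ beyond k ∣ ℕ.≤? n)
    where
    open Outer
    choose : Dec (2 * ∣ beyond k ∣ ≤ n) → IsoperimetricWitness ∣ A ∣ k
    choose (yes 2∣beyond∣≤n) = beyond k , 2∣beyond∣≤n , ∂out-beyond⊆layer k , (begin
      ∣ A ∣                                      ≤⟨ 2*m≤n⇒m≤o+[n∸p] 2∣A∣≤n (∣p∪q∣≤∣p∣+∣q∣ A (∂out G A)) ⟩
      ∣ ∂out G A ∣ ℕ.+ (n ℕ.∸ ∣ A ∪ ∂out G A ∣)  ≡⟨ cong (∣ ∂out G A ∣ ℕ.+_) (∣∁p∣≡n∸∣p∣ (A ∪ ∂out G A)) ⟨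
      ∣ ∂out G A ∣ ℕ.+ ∣ Vplus G A false ∣        ≡⟨ ∣layers∣+∣beyond∣ (Vplus∩∂out-empty false) k ⟨
      sumToℕ (∣_∣ ∘ layer) k ℕ.+ ∣ beyond k ∣    ∎)
      where open ℕ.≤-Reasoning
    choose (no 2∣beyond∣≰n) =
      ∁ (beyond k ∪ layer k) , 2∣X∣≤n , ∂out-∁-⊆ G {beyond k} {layer k} (∂out-beyond⊆layer k) ,
      ℕ.≤-trans (p⊆q⇒∣p∣≤∣q∣ A⊆X) (ℕ.m≤n+m _ _)
      where
      A⊆X : A ⊆ ∁ (beyond k ∪ layer k)
      A⊆X v∈A = x∉p⇒x∈∁p λ v∈ → [ (λ v∈P → x∈∁p⇒x∉p v∈P (p⊆p∪q (∂out G A) v∈A))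
                                 , (λ v∈∂A → proj₁ (∈∂out⁻ G v∈∂A) v∈A) ]′
                                 (x∈p∪q⁻ (Vplus G A false) _ (beyond∪layer⊆P∪S k v∈))
      2∣X∣≤n : 2 * ∣ ∁ (beyond k ∪ layer k) ∣ ≤ n
      2∣X∣≤n = begin
        2 * ∣ ∁ (beyond k ∪ layer k) ∣      ≡⟨ cong (2 *_) (∣∁p∣≡n∸∣p∣ (beyond k ∪ layer k)) ⟩
        2 * (n ℕ.∸ ∣ beyond k ∪ layer k ∣)  ≤⟨ ℕ.*-monoʳ-≤ 2 (ℕ.∸-monoʳ-≤ n (∣p∣≤∣p∪q∣ (beyond k) (layer k))) ⟩
        2 * (n ℕ.∸ ∣ beyond k ∣)            ≤⟨ 2*[n∸m]≤n {∣ beyond k ∣} (ℕ.<⇒≤ (ℕ.≰⇒> 2∣beyond∣≰n)) ⟩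
        n                                  ∎
        where open ℕ.≤-Reasoning

  isoperimetric-witness : 2 * ∣ A ∣ ≤ n → ∀ b k →
    Separated.IsoperimetricWitness G (∂out G A) (Vplus G A b) (Vplus-∂out⊆∂out b) ∣ A ∣ k
  isoperimetric-witness 2∣A∣≤n true  = inner-witness 2∣A∣≤n
  isoperimetric-witness 2∣A∣≤n false = outer-witness 2∣A∣≤n

lemma5p7 : (n d : ℕ) (G : Graph n) → Regular G d → Connected G →
    (h : ℚ) → IsHout G h →
    (A : Subset n) → Admissible G A → ratio G A ≡ h →
    (ν : ℕ → ℚ) →
    (∀ (b : Bool) (k : ℕ) (S : Subset n) →
      IsFibre G (∂out G A) (Vplus G A b) (Vminus G A b) (+ k) S →
      ℕ→ℚ ∣ S ∣ ≤ℚ (ℕ→ℚ ∣ ∂out G A ∣ *ℚ ν k)) →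
    (b : Bool) (k : ℕ) (S : Subset n) →
    IsFibre G (∂out G A) (Vplus G A b) (Vminus G A b) (+ k) S →
    (ℕ→ℚ ∣ ∂out G A ∣ *ℚ (1ℚ - h *ℚ sumTo ν k)) ≤ℚ ℕ→ℚ ∣ S ∣
lemma5p7 n d G _ _ h (_ , h≤ratio) A (A≢∅ , 2∣A∣≤n) ratioA≡h ν fibre≤ b k F F-isFibre =
  subst (λ L → ℕ→ℚ ∣ ∂out G A ∣ *ℚ (1ℚ - h *ℚ sumTo ν k) ≤ℚ ℕ→ℚ ∣ L ∣)
    (isFibre-unique (layer-isFibre (Vminus G A b) k) F-isFibre)
    (layer-lower-bound {k = k} ν h≤ratio 0≤h h∣A∣≡∣∂A∣ layer≤ (isoperimetric-witness G A 2∣A∣≤n b k))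
  where
  open Separated G (∂out G A) (Vplus G A b) (Vplus-∂out⊆∂out G A b)
  0≤h : 0ℚ ≤ℚ h
  0≤h = subst (0ℚ ≤ℚ_) ratioA≡h (0≤ratio G A)
  h∣A∣≡∣∂A∣ : h *ℚ ℕ→ℚ ∣ A ∣ ≡ ℕ→ℚ ∣ ∂out G A ∣
  h∣A∣≡∣∂A∣ = subst (λ r → r *ℚ ℕ→ℚ ∣ A ∣ ≡ ℕ→ℚ ∣ ∂out G A ∣) ratioA≡h (ratio-*-∣∣ G A A≢∅)
  layer≤ : ∀ i → ℕ→ℚ ∣ layer i ∣ ≤ℚ ℕ→ℚ ∣ ∂out G A ∣ *ℚ ν i
  layer≤ i = fibre≤ b i (layer i) (layer-isFibre (Vminus G A b) i)
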